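{- Let $V$ be a vector space over $\mathbb{F}_2$ of dimension $2r$ ($r\geq1$) with a nondegenerate quadratic form $Q$, and suppose $V$ has a symmetric basis $\{v_1,\ldots,v_{2r}\}$. (i) If $r\equiv 0$ or $1\pmod 4$, then $Q$ is hyperbolic. (ii) If $r\equiv 2$ or $3\pmod 4$, then $Q$ is elliptic.
   Context: Associated bilinear form: $B(u,v)=Q(u+v)-Q(u)-Q(v)$; $Q$ nondegenerate means $B$ is. A basis $\{v_1,\ldots,v_d\}$ is symmetric if $Q(v_i)=0$ for all $i$ and $B(v_i,v_j)=1$ for all $i<j$. $Q$ is hyperbolic if $V$ has a basis $e_1,\ldots,e_r,f_1,\ldots,f_r$ with $Q(e_i)=Q(f_i)=0$ and $B(e_i,f_j)=\delta_{ij}$, $B(e_i,e_j)=B(f_i,f_j)=0$; $Q$ is elliptic if $V$ has a basis $e_1,\ldots,e_{r-1},f_1,\ldots,f_{r-1},x,y$ with $Q(e_i)=Q(f_i)=0$, $B(e_i,f_j)=\delta_{ij}$, $e_i,f_i$ orthogonal to $x,y$, $Q(x)=Q(y)=1$, $B(x,y)=1$. Every nondegenerate quadratic form on an even-dimensional $\mathbb{F}_2$-space is of exactly one of these two types. -}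

module Defs where

open import Data.Bool using (Bool; true; false; _xor_; _∧_)
open import Data.Nat using (ℕ; zero; suc; _+_; pred)
open import Data.Fin using (Fin; _<_)
import Data.Fin as Fin
open import Data.Vec using (Vec; zipWith; replicate)
open import Data.Vec.Functional using (Vector; _++_; _∷_; [])
open import Data.Product using (Σ; ∃; _×_)
open import Relation.Binary.PropositionalEquality using (_≡_)
open import Relation.Nullary.Decidable using (⌊_⌋)

V : ℕ → Set
V n = Vec Bool n

_⊕_ : ∀ {n} → V n → V n → V n
_⊕_ = zipWith _xor_

0V : ∀ {n} → V n
0V = replicate _ false

_·_ : ∀ {n} → Bool → V n → V n
true  · v = v
false · v = 0V

lincomb : ∀ {m n} → Vector Bool m → Vector (V n) m → V n
lincomb {zero}  c w = 0V
lincomb {suc m} c w = (c Fin.zero · w Fin.zero) ⊕ lincomb (λ i → c (Fin.suc i)) (λ i → w (Fin.suc i))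

IsBasis : ∀ {m n} → Vector (V n) m → Set
IsBasis {m} {n} w =
  ((x : V n) → ∃ λ (c : Vector Bool m) → lincomb c w ≡ x) ×
  ((c : Vector Bool m) → lincomb c w ≡ 0V → ∀ i → c i ≡ false)

B : ∀ {n} → (V n → Bool) → V n → V n → Bool
B Q u v = Q (u ⊕ v) xor Q u xor Q v

-- quadratic form over F₂: Q(a v) = a² Q(v) (i.e. Q 0 = 0) and B bilinear
-- (B is symmetric by definition, so linearity in the first argument suffices)
IsQuadraticForm : ∀ {n} → (V n → Bool) → Set
IsQuadraticForm {n} Q =
  (Q 0V ≡ false) ×
  ((u u' w : V n) → B Q (u ⊕ u') w ≡ (B Q u w xor B Q u' w))

Nondegenerate : ∀ {n} → (V n → Bool) → Set
Nondegenerate {n} Q = (u : V n) → ((v : V n) → B Q u v ≡ false) → u ≡ 0V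

IsSymmetricBasis : ∀ {m n} → (V n → Bool) → Vector (V n) m → Set
IsSymmetricBasis Q v =
  IsBasis v × (∀ i → Q (v i) ≡ false) × (∀ i j → i < j → B Q (v i) (v j) ≡ true)

δ : ∀ {k} → Fin k → Fin k → Bool
δ i j = ⌊ i Fin.≟ j ⌋

HypPairs : ∀ {k n} → (V n → Bool) → Vector (V n) k → Vector (V n) k → Set
HypPairs Q e f =
  (∀ i → Q (e i) ≡ false) × (∀ i → Q (f i) ≡ false) ×
  (∀ i j → B Q (e i) (f j) ≡ δ i j) ×
  (∀ i j → B Q (e i) (e j) ≡ false) × (∀ i j → B Q (f i) (f j) ≡ false)

IsHyperbolic : ∀ {n} → ℕ → (V n → Bool) → Set
IsHyperbolic {n} r Q =
  Σ (Vector (V n) r) λ e → Σ (Vector (V n) r) λ f →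
    IsBasis (e ++ f) × HypPairs Q e f

IsElliptic : ∀ {n} → ℕ → (V n → Bool) → Set
IsElliptic {n} r Q =
  Σ (Vector (V n) (pred r)) λ e → Σ (Vector (V n) (pred r)) λ f →
  Σ (V n) λ x → Σ (V n) λ y →
    IsBasis ((e ++ f) ++ (x ∷ (y ∷ []))) × HypPairs Q e f ×
    (∀ i → B Q (e i) x ≡ false) × (∀ i → B Q (e i) y ≡ false) ×
    (∀ i → B Q (f i) x ≡ false) × (∀ i → B Q (f i) y ≡ false) ×
    (Q x ≡ true) × (Q y ≡ true) × (B Q x y ≡ true)

module Submission where

-- Call a family equilateral of value q if Q takes the value q on each member and B the value 1
-- on any two distinct members; a symmetric basis is equilateral of value 0. If u₀, u₁, … is
-- equilateral of value q, then u₀, u₁ span a plane that is hyperbolic for q = 0 and anisotropic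
-- for q = 1, and the vectors uₖ + u₀ + u₁ (k ≥ 2) are orthogonal to it and again equilateral,
-- of value 1 + q. Peeling off planes therefore splits V into r orthogonal planes, alternately
-- hyperbolic and anisotropic. Two orthogonal anisotropic planes span a hyperbolic space, so Q is
-- elliptic exactly when the number ⌊r/2⌋ of anisotropic planes is odd, i.e. when r ≡ 2, 3 mod 4.

open import Defs
open import Data.Bool using (Bool; true; false; not; _xor_; _∧_)
open import Data.Bool.Properties
  using (xor-comm; xor-assoc; xor-same; xor-identityʳ; not-involutive; ∧-zeroʳ; ∧-identityʳ)
open import Data.Empty using (⊥; ⊥-elim)
open import Data.Fin using (Fin; zero; suc; _↑ˡ_; _↑ʳ_; splitAt; join; cast; _≟_)
open import Data.Fin.Properties
  using (↑ˡ-injective; ↑ʳ-injective; splitAt-↑ˡ; splitAt-↑ʳ; join-splitAt; cast-involutive;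
         <-cmp)
open import Data.Nat using (ℕ; _+_; _*_; _%_; _≥_)
open import Data.Nat.Properties using (*-comm)
open import Data.Product using (Σ; ∃; _×_; _,_; proj₁; proj₂)
open import Data.Sum using (_⊎_; inj₁; inj₂)
import Data.Vec as Vec
open import Data.Vec.Functional using (Vector; _++_; _∷_; [])
open import Data.Vec.Functional.Properties using (lookup-++ˡ; lookup-++ʳ)
open import Data.Vec.Relation.Binary.Pointwise.Inductive
  using (Pointwise-≡⇒≡; zipWith-comm; zipWith-assoc; zipWith-identityˡ; zipWith-identityʳ)
open import Function using (_∘_)
open import Relation.Binary using (tri<; tri≈; tri>)
open import Relation.Binary.PropositionalEquality
open import Relation.Nullary using (yes; no)

⊕-comm : ∀ {n} (u v : V n) → u ⊕ v ≡ v ⊕ u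
⊕-comm u v = Pointwise-≡⇒≡ (zipWith-comm xor-comm u v)

⊕-assoc : ∀ {n} (u v w : V n) → (u ⊕ v) ⊕ w ≡ u ⊕ (v ⊕ w)
⊕-assoc u v w = Pointwise-≡⇒≡ (zipWith-assoc xor-assoc u v w)

⊕-identityˡ : ∀ {n} (u : V n) → 0V ⊕ u ≡ u
⊕-identityˡ u = Pointwise-≡⇒≡ (zipWith-identityˡ (λ _ → refl) u)

⊕-identityʳ : ∀ {n} (u : V n) → u ⊕ 0V ≡ u
⊕-identityʳ u = Pointwise-≡⇒≡ (zipWith-identityʳ xor-identityʳ u)

⊕-self : ∀ {n} (u : V n) → u ⊕ u ≡ 0V
⊕-self Vec.[]       = refl
⊕-self (a Vec.∷ u) = cong₂ Vec._∷_ (xor-same a) (⊕-self u)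

⊕-cancelʳ : ∀ {n} (u v : V n) → (u ⊕ v) ⊕ v ≡ u
⊕-cancelʳ u v = begin
  (u ⊕ v) ⊕ v  ≡⟨ ⊕-assoc u v v ⟩
  u ⊕ (v ⊕ v)  ≡⟨ cong (u ⊕_) (⊕-self v) ⟩
  u ⊕ 0V       ≡⟨ ⊕-identityʳ u ⟩
  u            ∎
  where open ≡-Reasoning

⊕-cancelˡ : ∀ {n} (u v : V n) → u ⊕ (u ⊕ v) ≡ v
⊕-cancelˡ u v = begin
  u ⊕ (u ⊕ v)  ≡⟨ cong (u ⊕_) (⊕-comm u v) ⟩
  u ⊕ (v ⊕ u)  ≡⟨ ⊕-comm u (v ⊕ u) ⟩
  (v ⊕ u) ⊕ u  ≡⟨ ⊕-cancelʳ v u ⟩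
  v            ∎
  where open ≡-Reasoning

⊕-interchange : ∀ {n} (a b c d : V n) → (a ⊕ b) ⊕ (c ⊕ d) ≡ (a ⊕ c) ⊕ (b ⊕ d)
⊕-interchange a b c d = begin
  (a ⊕ b) ⊕ (c ⊕ d)  ≡⟨ ⊕-assoc a b (c ⊕ d) ⟩
  a ⊕ (b ⊕ (c ⊕ d))  ≡⟨ cong (a ⊕_) (sym (⊕-assoc b c d)) ⟩
  a ⊕ ((b ⊕ c) ⊕ d)  ≡⟨ cong (λ z → a ⊕ (z ⊕ d)) (⊕-comm b c) ⟩
  a ⊕ ((c ⊕ b) ⊕ d)  ≡⟨ cong (a ⊕_) (⊕-assoc c b d) ⟩
  a ⊕ (c ⊕ (b ⊕ d))  ≡⟨ sym (⊕-assoc a c (b ⊕ d)) ⟩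
  (a ⊕ c) ⊕ (b ⊕ d)  ∎
  where open ≡-Reasoning

·-distribʳ-xor : ∀ {n} (a b : Bool) (u : V n) → (a · u) ⊕ (b · u) ≡ (a xor b) · u
·-distribʳ-xor true  true  u = ⊕-self u
·-distribʳ-xor true  false u = ⊕-identityʳ u
·-distribʳ-xor false b     u = ⊕-identityˡ (b · u)

module _ {n : ℕ} where

  record InSpan {m} (g : Vector (V n) m) (z : V n) : Set where
    constructor _,_
    field
      coefficients : Vector Bool m
      lincomb≡     : lincomb coefficients g ≡ z

  infix 4 _≼_ _≈_

  _≼_ : ∀ {k m} → Vector (V n) k → Vector (V n) m → Set
  h ≼ g = ∀ i → InSpan g (h i)

  _≈_ : ∀ {k m} → Vector (V n) k → Vector (V n) m → Set
  h ≈ g = h ≼ g × g ≼ h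

  lincomb-zero : ∀ {m} (g : Vector (V n) m) → lincomb (λ _ → false) g ≡ 0V
  lincomb-zero {ℕ.zero}  g = refl
  lincomb-zero {ℕ.suc m} g = trans (⊕-identityˡ _) (lincomb-zero (g ∘ suc))

  lincomb-⊕ : ∀ {m} (c d : Vector Bool m) (g : Vector (V n) m) →
    lincomb c g ⊕ lincomb d g ≡ lincomb (λ i → c i xor d i) g
  lincomb-⊕ {ℕ.zero}  c d g = ⊕-identityˡ 0V
  lincomb-⊕ {ℕ.suc m} c d g =
    trans (⊕-interchange (c zero · g zero) _ (d zero · g zero) _)
          (cong₂ _⊕_ (·-distribʳ-xor (c zero) (d zero) (g zero))
                     (lincomb-⊕ (c ∘ suc) (d ∘ suc) (g ∘ suc)))

  InSpan-0V : ∀ {m} (g : Vector (V n) m) → InSpan g 0V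
  InSpan-0V g = (λ _ → false) , lincomb-zero g

  InSpan-⊕ : ∀ {m} {g : Vector (V n) m} {x y} → InSpan g x → InSpan g y → InSpan g (x ⊕ y)
  InSpan-⊕ {g = g} (c , refl) (d , refl) = (λ i → c i xor d i) , sym (lincomb-⊕ c d g)

  InSpan-∈ : ∀ {m} (g : Vector (V n) m) i → InSpan g (g i)
  InSpan-∈ g zero    = (true ∷ λ _ → false) ,
                       trans (cong (g zero ⊕_) (lincomb-zero (g ∘ suc))) (⊕-identityʳ (g zero))
  InSpan-∈ g (suc i) with InSpan-∈ (g ∘ suc) i
  ... | c , p = (false ∷ c) , trans (⊕-identityˡ _) p

  InSpan-≼ : ∀ {k m} {h : Vector (V n) k} {g : Vector (V n) m} {z} →
    InSpan h z → h ≼ g → InSpan g z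
  InSpan-≼ {ℕ.zero}          (c , refl) h≼g = InSpan-0V _
  InSpan-≼ {ℕ.suc k} {h = h} (c , refl) h≼g =
    InSpan-⊕ (scaled (c zero)) (InSpan-≼ (c ∘ suc , refl) (h≼g ∘ suc))
    where
    scaled : ∀ b → InSpan _ (b · h zero)
    scaled true  = h≼g zero
    scaled false = InSpan-0V _

  ≼-refl : ∀ {m} {g : Vector (V n) m} → g ≼ g
  ≼-refl {g = g} = InSpan-∈ g

  ≼-trans : ∀ {k l m} {h : Vector (V n) k} {g : Vector (V n) l} {f : Vector (V n) m} →
    h ≼ g → g ≼ f → h ≼ f
  ≼-trans h≼g g≼f i = InSpan-≼ (h≼g i) g≼f

  ≈-trans : ∀ {k l m} {h : Vector (V n) k} {g : Vector (V n) l} {f : Vector (V n) m} →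
    h ≈ g → g ≈ f → h ≈ f
  ≈-trans (h≼g , g≼h) (g≼f , f≼g) = ≼-trans h≼g g≼f , ≼-trans f≼g g≼h

  ≼-∷ : ∀ {m} {x} {g : Vector (V n) m} → g ≼ (x ∷ g)
  ≼-∷ {x = x} {g} i = InSpan-∈ (x ∷ g) (suc i)

  ≼-cast : ∀ {k m} (eq : k ≡ m) {g : Vector (V n) m} → g ≼ (g ∘ cast eq)
  ≼-cast eq {g} i = subst (InSpan (g ∘ cast eq)) (cong g (cast-involutive eq (sym eq) i))
                      (InSpan-∈ (g ∘ cast eq) (cast (sym eq) i))

  ∷-≼ : ∀ {k m} {x} {h : Vector (V n) k} {g : Vector (V n) m} →
    InSpan g x → h ≼ g → (x ∷ h) ≼ g
  ∷-≼ x∈g h≼g zero    = x∈g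
  ∷-≼ x∈g h≼g (suc i) = h≼g i

  ≼-++ˡ : ∀ {k m} {h : Vector (V n) k} {g : Vector (V n) m} → h ≼ (h ++ g)
  ≼-++ˡ {h = h} {g} i = subst (InSpan (h ++ g)) (lookup-++ˡ h g i) (InSpan-∈ (h ++ g) _)

  ≼-++ʳ : ∀ {k m} {h : Vector (V n) k} {g : Vector (V n) m} → g ≼ (h ++ g)
  ≼-++ʳ {h = h} {g} i = subst (InSpan (h ++ g)) (lookup-++ʳ h g i) (InSpan-∈ (h ++ g) _)

  ++-≼ : ∀ {k l m} {h : Vector (V n) k} {g : Vector (V n) l} {f : Vector (V n) m} →
    h ≼ f → g ≼ f → (h ++ g) ≼ f
  ++-≼ {k} h≼f g≼f i with splitAt k i
  ... | inj₁ j = h≼f j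
  ... | inj₂ j = g≼f j

↑-induction : ∀ {a b} (P : Fin (a + b) → Set) →
  (∀ i → P (i ↑ˡ b)) → (∀ j → P (a ↑ʳ j)) → ∀ k → P k
↑-induction {a} {b} P left right k = subst P (join-splitAt a b k) (cases (splitAt a k))
  where
  cases : ∀ s → P (join a b s)
  cases (inj₁ i) = left i
  cases (inj₂ j) = right j

↑ˡ≢↑ʳ : ∀ {a b} (i : Fin a) (j : Fin b) → i ↑ˡ b ≢ a ↑ʳ j
↑ˡ≢↑ʳ {a} {b} i j eq
  with trans (sym (splitAt-↑ˡ a i b)) (trans (cong (splitAt a) eq) (splitAt-↑ʳ a b j))
... | ()

δ-refl : ∀ {k} (i : Fin k) → δ i i ≡ true
δ-refl i with i ≟ i
... | yes _  = refl
... | no i≢i = ⊥-elim (i≢i refl)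

δ-≢ : ∀ {k} {i j : Fin k} → i ≢ j → δ i j ≡ false
δ-≢ {i = i} {j} i≢j with i ≟ j
... | yes i≡j = ⊥-elim (i≢j i≡j)
... | no _    = refl

δ-sym : ∀ {k} (i j : Fin k) → δ i j ≡ δ j i
δ-sym i j with i ≟ j
... | yes refl = sym (δ-refl i)
... | no i≢j   = sym (δ-≢ (i≢j ∘ sym))

δ-injective : ∀ {k l} (σ : Fin k → Fin l) → (∀ {i j} → σ i ≡ σ j → i ≡ j) →
  ∀ i j → δ (σ i) (σ j) ≡ δ i j
δ-injective σ σ-inj i j with i ≟ j
... | yes refl = δ-refl (σ i)
... | no i≢j   = δ-≢ (i≢j ∘ σ-inj)

δ-suc : ∀ {k} (i j : Fin k) → δ (suc i) (suc j) ≡ δ i j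
δ-suc = δ-injective suc λ { refl → refl }

-- The parity of the number of anisotropic planes peeled off an equilateral family of value q
-- and size 2r.
arf : Bool → ℕ → Bool
arf q ℕ.zero    = false
arf q (ℕ.suc r) = q xor arf (not q) r

arf-mod-4 : ∀ r → arf false r ≡ arf false (r % 4)
arf-mod-4 0 = refl
arf-mod-4 1 = refl
arf-mod-4 2 = refl
arf-mod-4 3 = refl
arf-mod-4 (ℕ.suc (ℕ.suc (ℕ.suc (ℕ.suc r)))) = trans (not-involutive (arf false r)) (arf-mod-4 r)

-- Quadratic forms over F₂

module QuadraticForm {n : ℕ} (Q : V n → Bool) (isQ : IsQuadraticForm Q) where

  Q-0V : Q 0V ≡ false
  Q-0V = proj₁ isQ

  B-⊕ˡ : ∀ u u' w → B Q (u ⊕ u') w ≡ B Q u w xor B Q u' w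
  B-⊕ˡ = proj₂ isQ

  B-sym : ∀ u v → B Q u v ≡ B Q v u
  B-sym u v = cong₂ _xor_ (cong Q (⊕-comm u v)) (xor-comm (Q u) (Q v))

  B-⊕ʳ : ∀ w u u' → B Q w (u ⊕ u') ≡ B Q w u xor B Q w u'
  B-⊕ʳ w u u' rewrite B-sym w (u ⊕ u') | B-sym w u | B-sym w u' = B-⊕ˡ u u' w

  B-self : ∀ u → B Q u u ≡ false
  B-self u rewrite ⊕-self u | Q-0V = xor-same (Q u)

  B-0V : ∀ w → B Q 0V w ≡ false
  B-0V w rewrite ⊕-identityˡ w | Q-0V = xor-same (Q w)

  B-·ˡ : ∀ b u w → B Q (b · u) w ≡ b ∧ B Q u w
  B-·ˡ true  u w = refl
  B-·ˡ false u w = B-0V w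

  Q-⊕ : ∀ u v → Q (u ⊕ v) ≡ (Q u xor Q v) xor B Q u v
  Q-⊕ u v with Q (u ⊕ v) | Q u | Q v
  ... | true  | true  | true  = refl
  ... | true  | true  | false = refl
  ... | true  | false | true  = refl
  ... | true  | false | false = refl
  ... | false | true  | true  = refl
  ... | false | true  | false = refl
  ... | false | false | true  = refl
  ... | false | false | false = refl

  Q-⊕-≡ : ∀ {u v a b c} → Q u ≡ a → Q v ≡ b → B Q u v ≡ c → Q (u ⊕ v) ≡ (a xor b) xor c
  Q-⊕-≡ {u} {v} Qu Qv Buv = trans (Q-⊕ u v) (cong₂ _xor_ (cong₂ _xor_ Qu Qv) Buv)

  B-·ʳ : ∀ b w u → B Q w (b · u) ≡ b ∧ B Q w u
  B-·ʳ b w u = trans (B-sym w (b · u)) (trans (B-·ˡ b u w) (cong (b ∧_) (B-sym u w)))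

  infix 4 _⟂_

  _⟂_ : ∀ {m} → V n → Vector (V n) m → Set
  x ⟂ g = ∀ i → B Q x (g i) ≡ false

  ⟂-InSpan : ∀ {m} {x} {g : Vector (V n) m} {z} → x ⟂ g → InSpan g z → B Q x z ≡ false
  ⟂-InSpan {ℕ.zero}  {x}      x⟂g (c , refl) = trans (B-sym x 0V) (B-0V x)
  ⟂-InSpan {ℕ.suc m} {x} {g} x⟂g (c , refl) =
    trans (B-⊕ʳ x (c zero · g zero) _)
          (cong₂ _xor_ (trans (B-·ʳ (c zero) x (g zero))
                              (trans (cong (c zero ∧_) (x⟂g zero)) (∧-zeroʳ (c zero))))
                       (⟂-InSpan (x⟂g ∘ suc) (c ∘ suc , refl)))

  ⟂-≼ : ∀ {k m} {x} {h : Vector (V n) k} {g : Vector (V n) m} → x ⟂ g → h ≼ g → x ⟂ h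
  ⟂-≼ x⟂g h≼g i = ⟂-InSpan x⟂g (h≼g i)

  ≼-⟂ : ∀ {k m} {z} {h : Vector (V n) k} {g : Vector (V n) m} →
    h ≼ g → z ⟂ g → ∀ i → B Q (h i) z ≡ false
  ≼-⟂ {z = z} {h} h≼g z⟂g i = trans (B-sym (h i) z) (⟂-≼ z⟂g h≼g i)

  ⟂-++ : ∀ {k m} {x} {h : Vector (V n) k} {g : Vector (V n) m} →
    x ⟂ h → x ⟂ g → x ⟂ (h ++ g)
  ⟂-++ {k} x⟂h x⟂g i with splitAt k i
  ... | inj₁ j = x⟂h j
  ... | inj₂ j = x⟂g j

  Dual : ∀ {m} → Vector (V n) m → Vector (V n) m → Set
  Dual g y = ∀ k i → B Q (g k) (y i) ≡ δ k i

  B-lincomb-dual : ∀ {m} (c : Vector Bool m) {g : Vector (V n) m} {z} i →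
    (∀ k → B Q (g k) z ≡ δ k i) → B Q (lincomb c g) z ≡ c i
  B-lincomb-dual c {g} {z} zero dual = begin
    B Q ((c zero · g zero) ⊕ lincomb (c ∘ suc) (g ∘ suc)) z
      ≡⟨ B-⊕ˡ (c zero · g zero) _ z ⟩
    B Q (c zero · g zero) z xor B Q (lincomb (c ∘ suc) (g ∘ suc)) z
      ≡⟨ cong₂ _xor_ (trans (B-·ˡ (c zero) (g zero) z) (cong (c zero ∧_) (dual zero)))
                     tail⟂z ⟩
    (c zero ∧ true) xor false
      ≡⟨ trans (xor-identityʳ _) (∧-identityʳ (c zero)) ⟩
    c zero ∎
    where
    open ≡-Reasoning
    tail⟂z : B Q (lincomb (c ∘ suc) (g ∘ suc)) z ≡ false
    tail⟂z = trans (B-sym _ z)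
                   (⟂-InSpan (λ k → trans (B-sym z _) (dual (suc k))) (c ∘ suc , refl))
  B-lincomb-dual c {g} {z} (suc i) dual = begin
    B Q ((c zero · g zero) ⊕ lincomb (c ∘ suc) (g ∘ suc)) z
      ≡⟨ B-⊕ˡ (c zero · g zero) _ z ⟩
    B Q (c zero · g zero) z xor B Q (lincomb (c ∘ suc) (g ∘ suc)) z
      ≡⟨ cong₂ _xor_ (trans (B-·ˡ (c zero) (g zero) z)
                            (trans (cong (c zero ∧_) (dual zero)) (∧-zeroʳ (c zero))))
                     (B-lincomb-dual (c ∘ suc) i (λ k → trans (dual (suc k)) (δ-suc k i))) ⟩
    false xor c (suc i) ∎
    where open ≡-Reasoning

  Dual⇒independent : ∀ {m} {g y : Vector (V n) m} → Dual g y →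
    ∀ c → lincomb c g ≡ 0V → ∀ i → c i ≡ false
  Dual⇒independent {g = g} {y} dual c c·g≡0 i = begin
    c i                        ≡⟨ B-lincomb-dual c i (λ k → dual k i) ⟨
    B Q (lincomb c g) (y i)    ≡⟨ cong (λ z → B Q z (y i)) c·g≡0 ⟩
    B Q 0V (y i)               ≡⟨ B-0V (y i) ⟩
    false                      ∎
    where open ≡-Reasoning

  Dual-++ : ∀ {a b} {g₁ y₁ : Vector (V n) a} {g₂ y₂ : Vector (V n) b} →
    Dual g₁ y₁ → Dual g₂ y₂ →
    (∀ k i → B Q (g₁ k) (y₂ i) ≡ false) → (∀ k i → B Q (g₂ k) (y₁ i) ≡ false) →
    Dual (g₁ ++ g₂) (y₁ ++ y₂)
  Dual-++ {a} {b} {g₁} {y₁} {g₂} {y₂} d₁ d₂ o₁₂ o₂₁ =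
    ↑-induction Row (λ k → ↑-induction _ (ll k) (lr k)) (λ k → ↑-induction _ (rl k) (rr k))
    where
    Row : Fin (a + b) → Set
    Row k = ∀ i → B Q ((g₁ ++ g₂) k) ((y₁ ++ y₂) i) ≡ δ k i
    ll : ∀ k i → B Q ((g₁ ++ g₂) (k ↑ˡ b)) ((y₁ ++ y₂) (i ↑ˡ b)) ≡ δ (k ↑ˡ b) (i ↑ˡ b)
    ll k i rewrite lookup-++ˡ g₁ g₂ k | lookup-++ˡ y₁ y₂ i
                 | δ-injective (_↑ˡ b) (λ {i} {j} → ↑ˡ-injective b i j) k i = d₁ k i
    lr : ∀ k i → B Q ((g₁ ++ g₂) (k ↑ˡ b)) ((y₁ ++ y₂) (a ↑ʳ i)) ≡ δ (k ↑ˡ b) (a ↑ʳ i)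
    lr k i rewrite lookup-++ˡ g₁ g₂ k | lookup-++ʳ y₁ y₂ i
                 | δ-≢ (↑ˡ≢↑ʳ k i) = o₁₂ k i
    rl : ∀ k i → B Q ((g₁ ++ g₂) (a ↑ʳ k)) ((y₁ ++ y₂) (i ↑ˡ b)) ≡ δ (a ↑ʳ k) (i ↑ˡ b)
    rl k i rewrite lookup-++ʳ g₁ g₂ k | lookup-++ˡ y₁ y₂ i
                 | δ-≢ (↑ˡ≢↑ʳ i k ∘ sym) = o₂₁ k i
    rr : ∀ k i → B Q ((g₁ ++ g₂) (a ↑ʳ k)) ((y₁ ++ y₂) (a ↑ʳ i)) ≡ δ (a ↑ʳ k) (a ↑ʳ i)
    rr k i rewrite lookup-++ʳ g₁ g₂ k | lookup-++ʳ y₁ y₂ i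
                 | δ-injective (a ↑ʳ_) (λ {i} {j} → ↑ʳ-injective a i j) k i = d₂ k i

  HypPairs⇒Dual : ∀ {h} {e f : Vector (V n) h} → HypPairs Q e f → Dual (e ++ f) (f ++ e)
  HypPairs⇒Dual (_ , _ , ef , ee , ff) =
    Dual-++ ef (λ k i → trans (B-sym _ _) (trans (ef i k) (δ-sym i k))) ee ff

  Plane : Bool → V n → V n → Set
  Plane q x y = Q x ≡ q × Q y ≡ q × B Q x y ≡ true

  private
    Q-∷ : ∀ {h} {z} {g : Vector (V n) h} → Q z ≡ false → (∀ i → Q (g i) ≡ false) →
      ∀ i → Q ((z ∷ g) i) ≡ false
    Q-∷ Qz Qg zero    = Qz
    Q-∷ Qz Qg (suc i) = Qg i

    B-∷ : ∀ {h} {z} {g : Vector (V n) h} → z ⟂ g → (∀ i j → B Q (g i) (g j) ≡ false) →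
      ∀ i j → B Q ((z ∷ g) i) ((z ∷ g) j) ≡ false
    B-∷ {z = z} z⟂g gg zero    zero    = B-self z
    B-∷         z⟂g gg zero    (suc j) = z⟂g j
    B-∷         z⟂g gg (suc i) zero    = trans (B-sym _ _) (z⟂g i)
    B-∷         z⟂g gg (suc i) (suc j) = gg i j

  HypPairs-∷ : ∀ {h} {x y} {e f : Vector (V n) h} → Plane false x y →
    x ⟂ e → x ⟂ f → y ⟂ e → y ⟂ f → HypPairs Q e f → HypPairs Q (x ∷ e) (y ∷ f)
  HypPairs-∷ {x = x} {y} {e} {f} (Qx , Qy , Bxy) x⟂e x⟂f y⟂e y⟂f (Qe , Qf , ef , ee , ff) =
    Q-∷ Qx Qe , Q-∷ Qy Qf , ef′ , B-∷ x⟂e ee , B-∷ y⟂f ff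
    where
    ef′ : ∀ i j → B Q ((x ∷ e) i) ((y ∷ f) j) ≡ δ i j
    ef′ zero    zero    = Bxy
    ef′ zero    (suc j) = x⟂f j
    ef′ (suc i) zero    = trans (B-sym _ _) (y⟂e i)
    ef′ (suc i) (suc j) = trans (ef i j) (sym (δ-suc i j))

  Equilateral : ∀ {m} → Bool → Vector (V n) m → Set
  Equilateral q u = (∀ i → Q (u i) ≡ q) × (∀ i j → i ≢ j → B Q (u i) (u j) ≡ true)

  module Peel {m} {q} (u : Vector (V n) (2 + m)) (u-equilateral : Equilateral q u) where

    private
      Qu = proj₁ u-equilateral
      Bu = proj₂ u-equilateral

    x y s : V n
    x = u zero
    y = u (suc zero)
    s = x ⊕ y

    rest : Vector (V n) m
    rest k = u (suc (suc k)) ⊕ s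

    plane : Plane q x y
    plane = Qu zero , Qu (suc zero) , Bu zero (suc zero) λ ()

    private
      Q-s : Q s ≡ true
      Q-s = trans (Q-⊕-≡ (Qu zero) (Qu (suc zero)) (Bu zero (suc zero) λ ()))
                  (cong (_xor true) (xor-same q))

      B-s : ∀ k → B Q (u (suc (suc k))) s ≡ false
      B-s k rewrite B-⊕ʳ (u (suc (suc k))) x y
                  | Bu (suc (suc k)) zero (λ ()) | Bu (suc (suc k)) (suc zero) (λ ()) = refl

    equilateral : Equilateral (not q) rest
    equilateral = Q-rest , B-rest
      where
      Q-rest : ∀ k → Q (rest k) ≡ not q
      Q-rest k = trans (Q-⊕-≡ (Qu (suc (suc k))) Q-s (B-s k))
                       (trans (xor-identityʳ _) (xor-comm q true))
      B-rest : ∀ k l → k ≢ l → B Q (rest k) (rest l) ≡ true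
      B-rest k l k≢l
        rewrite B-⊕ˡ (u (suc (suc k))) s (rest l) | B-⊕ʳ (u (suc (suc k))) (u (suc (suc l))) s
              | B-⊕ʳ s (u (suc (suc l))) s | B-s k | B-self s
              | B-sym s (u (suc (suc l))) | B-s l
              | Bu (suc (suc k)) (suc (suc l)) (k≢l ∘ λ { refl → refl }) = refl

    x⟂rest : x ⟂ rest
    x⟂rest k rewrite B-⊕ʳ x (u (suc (suc k))) s | B-⊕ʳ x x y | B-self x
                   | Bu zero (suc (suc k)) (λ ()) | Bu zero (suc zero) (λ ()) = refl

    y⟂rest : y ⟂ rest
    y⟂rest k rewrite B-⊕ʳ y (u (suc (suc k))) s | B-⊕ʳ y x y | B-self y
                   | Bu (suc zero) (suc (suc k)) (λ ()) | Bu (suc zero) zero (λ ()) = refl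

    peeled≈u : (x ∷ y ∷ rest) ≈ u
    peeled≈u = ∷-≼ (InSpan-∈ u zero) (∷-≼ (InSpan-∈ u (suc zero)) rest≼u) , u≼peeled
      where
      s∈u : InSpan u s
      s∈u = InSpan-⊕ (InSpan-∈ u zero) (InSpan-∈ u (suc zero))
      rest≼u : rest ≼ u
      rest≼u k = InSpan-⊕ (InSpan-∈ u (suc (suc k))) s∈u
      s∈peeled : InSpan (x ∷ y ∷ rest) s
      s∈peeled = InSpan-⊕ (InSpan-∈ (x ∷ y ∷ rest) zero)
                          (InSpan-∈ (x ∷ y ∷ rest) (suc zero))
      u≼peeled : u ≼ (x ∷ y ∷ rest)
      u≼peeled zero          = InSpan-∈ (x ∷ y ∷ rest) zero
      u≼peeled (suc zero)    = InSpan-∈ (x ∷ y ∷ rest) (suc zero)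
      u≼peeled (suc (suc k)) = subst (InSpan (x ∷ y ∷ rest)) (⊕-cancelʳ (u (suc (suc k))) s)
                                 (InSpan-⊕ (InSpan-∈ (x ∷ y ∷ rest) (suc (suc k))) s∈peeled)

  ⟂-⊕ : ∀ {m} {a b} {g : Vector (V n) m} → a ⟂ g → b ⟂ g → (a ⊕ b) ⟂ g
  ⟂-⊕ {a = a} {b} {g} a⟂g b⟂g i = trans (B-⊕ˡ a b (g i)) (cong₂ _xor_ (a⟂g i) (b⟂g i))

  ⟂-∷ : ∀ {m} {z x} {g : Vector (V n) m} → B Q z x ≡ false → z ⟂ g → z ⟂ (x ∷ g)
  ⟂-∷ Bzx z⟂g zero    = Bzx
  ⟂-∷ Bzx z⟂g (suc i) = z⟂g i

  -- An orthogonal sum of two anisotropic planes is hyperbolic.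
  module TwoAnisotropicPlanes {x y x′ y′} (P : Plane true x y) (P′ : Plane true x′ y′)
    (Bxx′ : B Q x x′ ≡ false) (Bxy′ : B Q x y′ ≡ false)
    (Byx′ : B Q y x′ ≡ false) (Byy′ : B Q y y′ ≡ false) where

    private
      Qx = proj₁ P
      Qy = proj₁ (proj₂ P)
      Bxy = proj₂ (proj₂ P)
      Qx′ = proj₁ P′
      Qy′ = proj₁ (proj₂ P′)
      Bx′y′ = proj₂ (proj₂ P′)

    e₁ f₁ s e₂ f₂ : V n
    e₁ = x ⊕ x′
    f₁ = y ⊕ x′
    s  = x ⊕ y
    e₂ = s ⊕ y′
    f₂ = e₂ ⊕ x′

    private
      Bx′y : B Q x′ y ≡ false
      Bx′y = trans (B-sym x′ y) Byx′

      Bxs : B Q x s ≡ true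
      Bxs rewrite B-⊕ʳ x x y | B-self x | Bxy = refl

      Bys : B Q y s ≡ true
      Bys rewrite B-⊕ʳ y x y | B-self y | B-sym y x | Bxy = refl

      Bx′s : B Q x′ s ≡ false
      Bx′s rewrite B-⊕ʳ x′ x y | B-sym x′ x | Bxx′ | Bx′y = refl

      Bsy′ : B Q s y′ ≡ false
      Bsy′ rewrite B-⊕ˡ x y y′ | Bxy′ | Byy′ = refl

      Be₂x′ : B Q e₂ x′ ≡ true
      Be₂x′ rewrite B-⊕ˡ s y′ x′ | B-sym s x′ | Bx′s | B-sym y′ x′ | Bx′y′ = refl

    hyperbolic₁ : Plane false e₁ f₁
    hyperbolic₁ = Q-e₁ , Q-f₁ , B-e₁f₁
      where
      Q-e₁ : Q e₁ ≡ false
      Q-e₁ = Q-⊕-≡ Qx Qx′ Bxx′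
      Q-f₁ : Q f₁ ≡ false
      Q-f₁ = Q-⊕-≡ Qy Qx′ Byx′
      B-e₁f₁ : B Q e₁ f₁ ≡ true
      B-e₁f₁ rewrite B-⊕ˡ x x′ f₁ | B-⊕ʳ x y x′ | B-⊕ʳ x′ y x′
                   | Bxy | Bxx′ | Bx′y | B-self x′ = refl

    hyperbolic₂ : Plane false e₂ f₂
    hyperbolic₂ = Q-e₂ , Q-f₂ , B-e₂f₂
      where
      Q-s : Q s ≡ true
      Q-s = Q-⊕-≡ Qx Qy Bxy
      Q-e₂ : Q e₂ ≡ false
      Q-e₂ = Q-⊕-≡ Q-s Qy′ Bsy′
      Q-f₂ : Q f₂ ≡ false
      Q-f₂ = Q-⊕-≡ Q-e₂ Qx′ Be₂x′
      B-e₂f₂ : B Q e₂ f₂ ≡ true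
      B-e₂f₂ rewrite B-⊕ʳ e₂ e₂ x′ | B-self e₂ | Be₂x′ = refl

    Be₁e₂ : B Q e₁ e₂ ≡ false
    Be₁e₂ rewrite B-⊕ˡ x x′ e₂ | B-⊕ʳ x s y′ | B-⊕ʳ x′ s y′
                | Bxs | Bxy′ | Bx′s | Bx′y′ = refl

    Bf₁e₂ : B Q f₁ e₂ ≡ false
    Bf₁e₂ rewrite B-⊕ˡ y x′ e₂ | B-⊕ʳ y s y′ | B-⊕ʳ x′ s y′
                | Bys | Byy′ | Bx′s | Bx′y′ = refl

    Be₁f₂ : B Q e₁ f₂ ≡ false
    Be₁f₂ rewrite B-⊕ʳ e₁ e₂ x′ | Be₁e₂ | B-⊕ˡ x x′ x′ | Bxx′ | B-self x′ = refl

    Bf₁f₂ : B Q f₁ f₂ ≡ false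
    Bf₁f₂ rewrite B-⊕ʳ f₁ e₂ x′ | Bf₁e₂ | B-⊕ˡ y x′ x′ | Byx′ | B-self x′ = refl

  -- Splittings of a span into hyperbolic planes and an orthogonal remainder

  record Splitting {m} (w : Vector (V n) m) (h k : ℕ) : Set where
    field
      e f    : Vector (V n) h
      core   : Vector (V n) k
      pairs  : HypPairs Q e f
      e⟂core : ∀ i → e i ⟂ core
      f⟂core : ∀ i → f i ⟂ core
      spans  : ((e ++ f) ++ core) ≈ w

    ef≼w : (e ++ f) ≼ w
    ef≼w = ≼-trans ≼-++ˡ (proj₁ spans)

    e≼w : e ≼ w
    e≼w = ≼-trans ≼-++ˡ ef≼w

    f≼w : f ≼ w
    f≼w = ≼-trans ≼-++ʳ ef≼w

    core≼w : core ≼ w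
    core≼w = ≼-trans ≼-++ʳ (proj₁ spans)

    core⟂e : ∀ j → core j ⟂ e
    core⟂e j i = trans (B-sym (core j) (e i)) (e⟂core i j)

    core⟂f : ∀ j → core j ⟂ f
    core⟂f j i = trans (B-sym (core j) (f i)) (f⟂core i j)

  open Splitting

  Splitting-≈ : ∀ {m m′ h k} {w : Vector (V n) m} {w′ : Vector (V n) m′} →
    w ≈ w′ → Splitting w h k → Splitting w′ h k
  Splitting-≈ w≈w′ sp = record
    { e = e sp ; f = f sp ; core = core sp ; pairs = pairs sp
    ; e⟂core = e⟂core sp ; f⟂core = f⟂core sp
    ; spans = ≈-trans (spans sp) w≈w′
    }

  hyperbolicSplitting : ∀ {h} {e f : Vector (V n) h} → HypPairs Q e f → Splitting (e ++ f) h 0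
  hyperbolicSplitting {e = e} {f} pairs = record
    { e = e ; f = f ; core = [] ; pairs = pairs
    ; e⟂core = λ _ () ; f⟂core = λ _ ()
    ; spans = ++-≼ ≼-refl (λ ()) , ≼-++ˡ
    }

  extendHyperbolic : ∀ {m h k} {x y} {w : Vector (V n) m} →
    Plane false x y → x ⟂ w → y ⟂ w → Splitting w h k → Splitting (x ∷ y ∷ w) (1 + h) k
  extendHyperbolic {h = h} {k} {x} {y} {w} plane x⟂w y⟂w sp = record
    { e = x ∷ e sp ; f = y ∷ f sp ; core = core sp
    ; pairs = HypPairs-∷ plane (⟂-≼ x⟂w (e≼w sp)) (⟂-≼ x⟂w (f≼w sp))
                               (⟂-≼ y⟂w (e≼w sp)) (⟂-≼ y⟂w (f≼w sp)) (pairs sp)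
    ; e⟂core = λ { zero → ⟂-≼ x⟂w (core≼w sp) ; (suc i) → e⟂core sp i }
    ; f⟂core = λ { zero → ⟂-≼ y⟂w (core≼w sp) ; (suc i) → f⟂core sp i }
    ; spans = ++-≼ (++-≼ (∷-≼ (InSpan-∈ _ zero) (≼-trans (e≼w sp) w≼xyw))
                         (∷-≼ (InSpan-∈ _ (suc zero)) (≼-trans (f≼w sp) w≼xyw)))
                   (≼-trans (core≼w sp) w≼xyw)
            , ∷-≼ (xe≼ zero) (∷-≼ (yf≼ zero) (≼-trans (proj₂ (spans sp)) old≼new))
    }
    where
    w≼xyw : w ≼ (x ∷ y ∷ w)
    w≼xyw = ≼-trans ≼-∷ ≼-∷
    new : Vector (V n) ((1 + h + (1 + h)) + k)
    new = ((x ∷ e sp) ++ (y ∷ f sp)) ++ core sp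
    xe≼ : (x ∷ e sp) ≼ new
    xe≼ = ≼-trans ≼-++ˡ ≼-++ˡ
    yf≼ : (y ∷ f sp) ≼ new
    yf≼ = ≼-trans (≼-++ʳ {h = x ∷ e sp}) ≼-++ˡ
    old≼new : ((e sp ++ f sp) ++ core sp) ≼ new
    old≼new = ++-≼ (++-≼ (≼-trans ≼-∷ xe≼) (≼-trans ≼-∷ yf≼)) ≼-++ʳ

  extendAnisotropic : ∀ {m h} {x y} {w : Vector (V n) m} →
    Plane true x y → x ⟂ w → y ⟂ w → Splitting w h 0 → Splitting (x ∷ y ∷ w) h 2
  extendAnisotropic {x = x} {y} {w} plane x⟂w y⟂w sp = record
    { e = e sp ; f = f sp ; core = x ∷ y ∷ [] ; pairs = pairs sp
    ; e⟂core = λ i → ⟂-∷ (≼-⟂ (e≼w sp) x⟂w i) (⟂-∷ (≼-⟂ (e≼w sp) y⟂w i) λ ())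
    ; f⟂core = λ i → ⟂-∷ (≼-⟂ (f≼w sp) x⟂w i) (⟂-∷ (≼-⟂ (f≼w sp) y⟂w i) λ ())
    ; spans = ++-≼ (≼-trans (ef≼w sp) (≼-trans ≼-∷ ≼-∷))
                   (∷-≼ (InSpan-∈ _ zero) (∷-≼ (InSpan-∈ _ (suc zero)) λ ()))
            , ∷-≼ (≼-++ʳ zero) (∷-≼ (≼-++ʳ (suc zero))
                (≼-trans (proj₂ (spans sp)) (++-≼ {g = core sp} ≼-++ˡ λ ())))
    }

  extendMerging : ∀ {m h} {x y} {w : Vector (V n) m} →
    Plane true x y → x ⟂ w → y ⟂ w →
    (sp : Splitting w h 2) → Plane true (core sp zero) (core sp (suc zero)) →
    Splitting (x ∷ y ∷ w) (2 + h) 0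
  extendMerging {x = x} {y} {w} plane x⟂w y⟂w sp plane′ =
    Splitting-≈ (merged≼xyw , xyw≼merged)
      (extendHyperbolic hyperbolic₁ (⟂-∷ Be₁e₂ (⟂-∷ Be₁f₂ (⟂-⊕ x⟂ef x′⟂ef)))
                                    (⟂-∷ Bf₁e₂ (⟂-∷ Bf₁f₂ (⟂-⊕ y⟂ef x′⟂ef)))
        (extendHyperbolic hyperbolic₂ e₂⟂ef (⟂-⊕ e₂⟂ef x′⟂ef)
          (hyperbolicSplitting (pairs sp))))
    where
    x′ y′ : V n
    x′ = core sp zero
    y′ = core sp (suc zero)
    x⟂core : x ⟂ core sp
    x⟂core = ⟂-≼ x⟂w (core≼w sp)
    y⟂core : y ⟂ core sp
    y⟂core = ⟂-≼ y⟂w (core≼w sp)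
    open TwoAnisotropicPlanes plane plane′
      (x⟂core zero) (x⟂core (suc zero)) (y⟂core zero) (y⟂core (suc zero))

    ef : Vector (V n) _
    ef = e sp ++ f sp
    x⟂ef : x ⟂ ef
    x⟂ef = ⟂-≼ x⟂w (ef≼w sp)
    y⟂ef : y ⟂ ef
    y⟂ef = ⟂-≼ y⟂w (ef≼w sp)
    x′⟂ef : x′ ⟂ ef
    x′⟂ef = ⟂-++ (core⟂e sp zero) (core⟂f sp zero)
    y′⟂ef : y′ ⟂ ef
    y′⟂ef = ⟂-++ (core⟂e sp (suc zero)) (core⟂f sp (suc zero))
    e₂⟂ef : e₂ ⟂ ef
    e₂⟂ef = ⟂-⊕ (⟂-⊕ x⟂ef y⟂ef) y′⟂ef

    merged : Vector (V n) _
    merged = e₁ ∷ f₁ ∷ e₂ ∷ f₂ ∷ ef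

    merged≼xyw : merged ≼ (x ∷ y ∷ w)
    merged≼xyw = ∷-≼ (InSpan-⊕ x∈ x′∈) (∷-≼ (InSpan-⊕ y∈ x′∈)
                   (∷-≼ e₂∈ (∷-≼ (InSpan-⊕ e₂∈ x′∈) (≼-trans (ef≼w sp) w≼))))
      where
      w≼ : w ≼ (x ∷ y ∷ w)
      w≼ = ≼-trans ≼-∷ ≼-∷
      x∈ = InSpan-∈ (x ∷ y ∷ w) zero
      y∈ = InSpan-∈ (x ∷ y ∷ w) (suc zero)
      x′∈ = ≼-trans (core≼w sp) w≼ zero
      e₂∈ = InSpan-⊕ (InSpan-⊕ x∈ y∈) (≼-trans (core≼w sp) w≼ (suc zero))

    xyw≼merged : (x ∷ y ∷ w) ≼ merged
    xyw≼merged = ∷-≼ x∈ (∷-≼ y∈ (≼-trans (proj₂ (spans sp)) (++-≼ ef≼ core≼)))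
      where
      ef≼ : ef ≼ merged
      ef≼ = ≼-trans ≼-∷ (≼-trans ≼-∷ (≼-trans ≼-∷ ≼-∷))
      e₂∈ = InSpan-∈ merged (suc (suc zero))
      x′∈ = subst (InSpan merged) (⊕-cancelˡ e₂ x′)
              (InSpan-⊕ e₂∈ (InSpan-∈ merged (suc (suc (suc zero)))))
      x∈  = subst (InSpan merged) (⊕-cancelʳ x x′) (InSpan-⊕ (InSpan-∈ merged zero) x′∈)
      y∈  = subst (InSpan merged) (⊕-cancelʳ y x′) (InSpan-⊕ (InSpan-∈ merged (suc zero)) x′∈)
      core≼ : core sp ≼ merged
      core≼ zero       = x′∈
      core≼ (suc zero) = subst (InSpan merged) (⊕-cancelˡ s y′) (InSpan-⊕ (InSpan-⊕ x∈ y∈) e₂∈)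

  Decomposition : ∀ {m} → Bool → ℕ → Vector (V n) m → Set
  Decomposition false r         w = Splitting w r 0
  Decomposition true  ℕ.zero    w = ⊥
  Decomposition true  (ℕ.suc r) w =
    Σ (Splitting w r 2) λ sp → Plane true (core sp zero) (core sp (suc zero))

  Decomposition-≈ : ∀ {m m′} {a} r {w : Vector (V n) m} {w′ : Vector (V n) m′} →
    w ≈ w′ → Decomposition a r w → Decomposition a r w′
  Decomposition-≈ {a = false} r         w≈w′ sp       = Splitting-≈ w≈w′ sp
  Decomposition-≈ {a = true}  (ℕ.suc r) w≈w′ (sp , p) = Splitting-≈ w≈w′ sp , p

  extend : ∀ {m} {q a} r {x y} {w : Vector (V n) m} → Plane q x y → x ⟂ w → y ⟂ w →
    Decomposition a r w → Decomposition (q xor a) (1 + r) (x ∷ y ∷ w)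
  extend {q = false} {false} r         p x⟂w y⟂w sp        = extendHyperbolic p x⟂w y⟂w sp
  extend {q = false} {true}  (ℕ.suc r) p x⟂w y⟂w (sp , p′) = extendHyperbolic p x⟂w y⟂w sp , p′
  extend {q = true}  {false} r         p x⟂w y⟂w sp        = extendAnisotropic p x⟂w y⟂w sp , p
  extend {q = true}  {true}  (ℕ.suc r) p x⟂w y⟂w (sp , p′) = extendMerging p x⟂w y⟂w sp p′

  decompose : ∀ {q} r (u : Vector (V n) (r * 2)) → Equilateral q u → Decomposition (arf q r) r u
  decompose ℕ.zero    u _ =
    Splitting-≈ ((λ ()) , (λ ()))
      (hyperbolicSplitting {e = []} {[]} ((λ ()) , (λ ()) , (λ ()) , (λ ()) , (λ ())))
  decompose (ℕ.suc r) u u-equilateral =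
    Decomposition-≈ (ℕ.suc r) peeled≈u
      (extend r plane x⟂rest y⟂rest (decompose r rest equilateral))
    where open Peel u u-equilateral

  IsSymmetricBasis⇒Equilateral : ∀ {m} {v : Vector (V n) m} →
    IsSymmetricBasis Q v → Equilateral false v
  IsSymmetricBasis⇒Equilateral {v = v} (_ , Qv , Bv) = Qv , B≡true
    where
    B≡true : ∀ i j → i ≢ j → B Q (v i) (v j) ≡ true
    B≡true i j i≢j with <-cmp i j
    ... | tri< i<j _ _ = Bv i j i<j
    ... | tri≈ _ i≡j _ = ⊥-elim (i≢j i≡j)
    ... | tri> _ _ j<i = trans (B-sym (v i) (v j)) (Bv j i j<i)

  Equilateral-cast : ∀ {k m} {q} (eq : k ≡ m) {u : Vector (V n) m} →
    Equilateral q u → Equilateral q (u ∘ cast eq)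
  Equilateral-cast eq (Qu , Bu) = Qu ∘ cast eq , λ i j i≢j → Bu _ _ (i≢j ∘ cast-injective)
    where
    cast-injective : ∀ {i j} → cast eq i ≡ cast eq j → i ≡ j
    cast-injective {i} {j} c =
      trans (sym (cast-involutive (sym eq) eq i))
            (trans (cong (cast (sym eq)) c) (cast-involutive (sym eq) eq j))

  Splitting⇒IsHyperbolic : ∀ {m h} {w : Vector (V n) m} →
    (∀ z → InSpan w z) → Splitting w h 0 → IsHyperbolic h Q
  Splitting⇒IsHyperbolic {w = w} w-spans sp =
    e sp , f sp , (ef-spans , Dual⇒independent (HypPairs⇒Dual (pairs sp))) , pairs sp
    where
    ef-spans : ∀ z → ∃ λ c → lincomb c (e sp ++ f sp) ≡ z
    ef-spans z with InSpan-≼ (w-spans z) (≼-trans (proj₂ (spans sp)) (++-≼ ≼-refl λ ()))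
    ... | c , p = c , p

  Decomposition⇒IsElliptic : ∀ {m} r {w : Vector (V n) m} →
    (∀ z → InSpan w z) → Decomposition true r w → IsElliptic r Q
  Decomposition⇒IsElliptic (ℕ.suc h) {w} w-spans (sp , Qx , Qy , Bxy) =
    e sp , f sp , x , y , (basis-spans , Dual⇒independent dual) , pairs sp ,
    (λ i → e⟂core sp i zero) , (λ i → e⟂core sp i (suc zero)) ,
    (λ i → f⟂core sp i zero) , (λ i → f⟂core sp i (suc zero)) ,
    Qx , Qy , Bxy
    where
    x y : V n
    x = core sp zero
    y = core sp (suc zero)
    basis : Vector (V n) _
    basis = (e sp ++ f sp) ++ (x ∷ y ∷ [])

    basis-spans : ∀ z → ∃ λ c → lincomb c basis ≡ z
    basis-spans z
      with InSpan-≼ (w-spans z) (≼-trans (proj₂ (spans sp)) (++-≼ ≼-++ˡ core≼basis))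
      where
      core≼basis : core sp ≼ basis
      core≼basis zero       = ≼-++ʳ zero
      core≼basis (suc zero) = ≼-++ʳ (suc zero)
    ... | c , p = c , p

    dual-xy : Dual (x ∷ y ∷ []) (y ∷ x ∷ [])
    dual-xy zero       zero       = Bxy
    dual-xy zero       (suc zero) = B-self x
    dual-xy (suc zero) zero       = B-self y
    dual-xy (suc zero) (suc zero) = trans (B-sym y x) Bxy

    dual : Dual basis ((f sp ++ e sp) ++ (y ∷ x ∷ []))
    dual = Dual-++ (HypPairs⇒Dual (pairs sp)) dual-xy ef⟂yx xy⟂fe
      where
      ef⟂yx : ∀ k i → B Q ((e sp ++ f sp) k) ((y ∷ x ∷ []) i) ≡ false
      ef⟂yx k zero       = trans (B-sym _ y)
                                   (⟂-++ (core⟂e sp (suc zero)) (core⟂f sp (suc zero)) k)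
      ef⟂yx k (suc zero) = trans (B-sym _ x) (⟂-++ (core⟂e sp zero) (core⟂f sp zero) k)
      xy⟂fe : ∀ k i → B Q ((x ∷ y ∷ []) k) ((f sp ++ e sp) i) ≡ false
      xy⟂fe zero       = ⟂-++ (core⟂f sp zero) (core⟂e sp zero)
      xy⟂fe (suc zero) = ⟂-++ (core⟂f sp (suc zero)) (core⟂e sp (suc zero))

lemma3p4 : (r : ℕ) → r ≥ 1 → (Q : V (2 * r) → Bool) →
    IsQuadraticForm Q → Nondegenerate Q →
    (v : Vector (V (2 * r)) (2 * r)) → IsSymmetricBasis Q v →
    ((r % 4 ≡ 0 ⊎ r % 4 ≡ 1) → IsHyperbolic r Q) ×
    ((r % 4 ≡ 2 ⊎ r % 4 ≡ 3) → IsElliptic r Q)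
lemma3p4 r _ Q isQ _ v v-basis = hyperbolic , elliptic
  where
  open QuadraticForm Q isQ
  -- Indexed by r * 2 rather than 2 * r, because suc r * 2 reduces to 2 + r * 2.
  u : Vector (V (2 * r)) (r * 2)
  u = v ∘ cast (*-comm r 2)

  u-spans : ∀ z → InSpan u z
  u-spans z with proj₁ (proj₁ v-basis) z
  ... | c , p = InSpan-≼ (c , p) (≼-cast (*-comm r 2))

  decomposition : ∀ {k} → r % 4 ≡ k → Decomposition (arf false k) r u
  decomposition r%4≡k =
    subst (λ a → Decomposition a r u) (trans (arf-mod-4 r) (cong (arf false) r%4≡k))
      (decompose r u (Equilateral-cast (*-comm r 2) (IsSymmetricBasis⇒Equilateral v-basis)))

  hyperbolic : (r % 4 ≡ 0 ⊎ r % 4 ≡ 1) → IsHyperbolic r Q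
  hyperbolic (inj₁ r%4≡0) = Splitting⇒IsHyperbolic u-spans (decomposition r%4≡0)
  hyperbolic (inj₂ r%4≡1) = Splitting⇒IsHyperbolic u-spans (decomposition r%4≡1)

  elliptic : (r % 4 ≡ 2 ⊎ r % 4 ≡ 3) → IsElliptic r Q
  elliptic (inj₁ r%4≡2) = Decomposition⇒IsElliptic r u-spans (decomposition r%4≡2)
  elliptic (inj₂ r%4≡3) = Decomposition⇒IsElliptic r u-spans (decomposition r%4≡3)
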